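{- Let $s\ge 2$ and let $H_1,\dots,H_s$ be pairwise vertex-disjoint connected finite simple graphs. Assume that for each $1\le i\le s$ there is a vertex $v_i\in V(H_i)$ such that $v_i$ is covered by every maximal matching $M$ of $H_i$ with $|M|=\mathrm{min\text{ - }match}(H_i)$. Let $v$ be a new vertex and let $G$ be the graph with $V(G)=\bigcup_{i=1}^s V(H_i)\cup\{v\}$ and $E(G)=\bigcup_{i=1}^s E(H_i)\cup\{\{v_i,v\}:1\le i\le s\}$. Then $\mathrm{min\text{ - }match}(G)=\sum_{i=1}^s\mathrm{min\text{ - }match}(H_i)$.
   Context: A matching is a set of pairwise disjoint edges; a maximal matching is a matching not properly contained in another matching; a vertex is covered by a matching if it lies in one of its edges. $\mathrm{min\text{ - }match}$ denotes the minimum size of a maximal matching. -}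

module Defs where

open import Data.Nat using (ℕ; zero; suc; _+_; _≤_)
open import Data.Fin using (Fin; zero; suc)
open import Data.List using (List; length; lookup)
open import Data.List.Membership.Propositional using (_∈_)
open import Data.Product using (Σ; Σ-syntax; ∃; ∃-syntax; _×_; _,_; proj₁; proj₂)
open import Data.Sum using (_⊎_; inj₁; inj₂)
open import Data.Unit using (⊤; tt)
open import Data.Empty using (⊥)
open import Relation.Nullary using (¬_)
open import Relation.Binary.PropositionalEquality using (_≡_; _≢_; refl)

record SimpleGraph (V : Set) : Set₁ where
  field
    Adj    : V → V → Set
    sym    : ∀ {x y} → Adj x y → Adj y x
    irrefl : ∀ {x} → ¬ Adj x x
open SimpleGraph public

FinGraph : ℕ → Set₁
FinGraph n = SimpleGraph (Fin n)

data Reach {V : Set} (G : SimpleGraph V) : V → V → Set where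
  here : ∀ {x} → Reach G x x
  step : ∀ {x y z} → Adj G x y → Reach G y z → Reach G x z

Connected : ∀ {V} → SimpleGraph V → Set
Connected G = ∀ x y → Reach G x y

-- An edge is a pair of adjacent vertices, regarded as the
-- unordered edge {a , b}; a matching is a finite list of edges which are
-- pairwise disjoint (for distinct positions in the list). Its size is
-- the length of the list (disjointness rules out repetitions).

Edge : Set → Set
Edge V = V × V

SameEdge : ∀ {V : Set} → Edge V → Edge V → Set
SameEdge (a , b) (c , d) = (a ≡ c × b ≡ d) ⊎ (a ≡ d × b ≡ c)

Disjoint : ∀ {V : Set} → Edge V → Edge V → Set
Disjoint (a , b) (c , d) = (a ≢ c) × (a ≢ d) × (b ≢ c) × (b ≢ d)

record IsMatching {V : Set} (G : SimpleGraph V) (M : List (Edge V)) : Set where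
  field
    edges    : ∀ {e} → e ∈ M → Adj G (proj₁ e) (proj₂ e)
    disjoint : ∀ (i j : Fin (length M)) → i ≢ j → Disjoint (lookup M i) (lookup M j)

_⊆ᴱ_ : ∀ {V : Set} → List (Edge V) → List (Edge V) → Set
M ⊆ᴱ M′ = ∀ {e} → e ∈ M → ∃[ e′ ] (e′ ∈ M′ × SameEdge e e′)

IsMaximalMatching : ∀ {V : Set} → SimpleGraph V → List (Edge V) → Set
IsMaximalMatching G M =
  IsMatching G M × (∀ M′ → IsMatching G M′ → M ⊆ᴱ M′ → M′ ⊆ᴱ M)

size : ∀ {V : Set} → List (Edge V) → ℕ
size = length

Covered : ∀ {V : Set} → V → List (Edge V) → Set
Covered x M = ∃[ e ] (e ∈ M × (x ≡ proj₁ e ⊎ x ≡ proj₂ e))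

IsMinMatch : ∀ {V : Set} → SimpleGraph V → ℕ → Set
IsMinMatch G k =
  (∃[ M ] (IsMaximalMatching G M × size M ≡ k)) ×
  (∀ M → IsMaximalMatching G M → k ≤ size M)

finSum : ∀ {s} → (Fin s → ℕ) → ℕ
finSum {zero}  f = 0
finSum {suc s} f = f zero + finSum (λ i → f (suc i))

-- The construction: disjoint union of H₁,…,Hₛ (H i on Fin (n i)) plus a
-- new vertex v (= inj₂ tt), joined to the chosen vertex vs i of each H i.

GVertex : (s : ℕ) → (n : Fin s → ℕ) → Set
GVertex s n = (Σ[ i ∈ Fin s ] Fin (n i)) ⊎ ⊤

module Glue (s : ℕ) (n : Fin s → ℕ) (H : (i : Fin s) → FinGraph (n i))
            (vs : (i : Fin s) → Fin (n i)) where

  data GAdj : GVertex s n → GVertex s n → Set where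
    inner : ∀ i x y → Adj (H i) x y → GAdj (inj₁ (i , x)) (inj₁ (i , y))
    toV   : ∀ i → GAdj (inj₁ (i , vs i)) (inj₂ tt)
    fromV : ∀ i → GAdj (inj₂ tt) (inj₁ (i , vs i))

  GAdj-sym : ∀ {x y} → GAdj x y → GAdj y x
  GAdj-sym (inner i x y a) = inner i y x (sym (H i) a)
  GAdj-sym (toV i)         = fromV i
  GAdj-sym (fromV i)       = toV i

  GAdj-irrefl : ∀ {x} → ¬ GAdj x x
  GAdj-irrefl (inner i x .x a) = irrefl (H i) a

  G : SimpleGraph (GVertex s n)
  G = record { Adj = GAdj ; sym = GAdj-sym ; irrefl = GAdj-irrefl }

glue : (s : ℕ) (n : Fin s → ℕ) (H : (i : Fin s) → FinGraph (n i))
       (vs : (i : Fin s) → Fin (n i)) → SimpleGraph (GVertex s n)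
glue s n H vs = Glue.G s n H vs

{-# OPTIONS --safe #-}
-- Upper bound: minimum maximal matchings Mᵢ of the Hᵢ together form a maximal matching of G,
-- since an edge inside Hᵢ is blocked by Mᵢ and the spoke vᵢv is blocked because Mᵢ covers vᵢ.
-- Lower bound: let M be maximal in G and Lᵢ its restriction to Hᵢ. If the spoke vᵢv is not in M,
-- Lᵢ is maximal in Hᵢ. If it is, every edge of Hᵢ extending Lᵢ passes through vᵢ, so Lᵢ plus
-- one such edge, if there is one, is maximal in Hᵢ. Either way min-match(Hᵢ) is at most the
-- number of edges of M inside Hᵢ or on the spoke at vᵢ, and these sets are disjoint for distinct i.
module Submission where

open import Defs
open import Data.Nat using (ℕ; zero; suc; _+_; _≤_; s≤s; z≤n)
open import Data.Nat.Properties
  using (+-commutativeSemigroup; ≤-trans; ≤-reflexive; +-mono-≤; m≤n+m; n≤1+n; _≤?_; module ≤-Reasoning)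
open import Algebra.Properties.CommutativeSemigroup +-commutativeSemigroup using (interchange)
open import Data.Fin as Fin using (Fin; zero; suc)
open import Data.Fin.Properties using (suc-injective)
open import Data.List using (List; []; _∷_; length; lookup; map; concat; tabulate; mapMaybe)
open import Data.Nat.ListAction using (sum)
open import Data.List.Properties using (length-++; length-map)
open import Data.List.Membership.Propositional using (_∈_; find; lose)
open import Data.List.Membership.Propositional.Properties
  using (∈-map⁺; ∈-map⁻; ∈-concat⁺′; ∈-concat⁻′; ∈-tabulate⁺; ∈-tabulate⁻; ∈-lookup)
open import Data.List.Relation.Unary.All as All using (All; []; _∷_)
import Data.List.Relation.Unary.All.Properties as All
open import Data.List.Relation.Unary.Any as Any using (Any; here; there; any?)
open import Data.List.Relation.Unary.Any.Properties using (lookup-index)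
open import Data.List.Relation.Unary.AllPairs as AllPairs using (AllPairs; []; _∷_)
import Data.List.Relation.Unary.AllPairs.Properties as AllPairs
open import Data.Maybe using (Maybe; just; nothing)
open import Data.Product using (∃-syntax; ∃₂; _×_; _,_; proj₁; proj₂)
import Data.Product.Properties as Product
open import Data.Sum using (_⊎_; inj₁; inj₂)
import Data.Sum.Properties as Sum
open import Data.Unit using (tt)
import Data.Unit.Properties as Unit
open import Data.Empty using (⊥-elim)
open import Function using (_∘_; case_of_)
open import Function.Definitions using (Injective)
open import Relation.Nullary using (¬_; Dec; yes; no)
open import Relation.Nullary.Decidable using (_×-dec_; _⊎-dec_; decidable-stable)
open import Relation.Binary.Definitions using (DecidableEquality; Symmetric)
open import Relation.Binary.PropositionalEquality
  using (_≡_; _≢_; refl; cong; cong₂; subst; subst₂; module ≡-Reasoning)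
  renaming (sym to ≡-sym; trans to ≡-trans)

module _ {V : Set} where

  Meets : V → Edge V → Set
  Meets x e = x ≡ proj₁ e ⊎ x ≡ proj₂ e

  Avoids : V → Edge V → Set
  Avoids x e = x ≢ proj₁ e × x ≢ proj₂ e

  Avoids⇒¬Meets : ∀ {x} {e : Edge V} → Avoids x e → ¬ Meets x e
  Avoids⇒¬Meets (x≢a , _) (inj₁ x≡a) = x≢a x≡a
  Avoids⇒¬Meets (_ , x≢b) (inj₂ x≡b) = x≢b x≡b

  ¬Meets⇒Avoids : ∀ {x} {e : Edge V} → ¬ Meets x e → Avoids x e
  ¬Meets⇒Avoids ¬meets = ¬meets ∘ inj₁ , ¬meets ∘ inj₂

  Meets? : DecidableEquality V → ∀ x e → Dec (Meets x e)
  Meets? _≟_ x (a , b) = (x ≟ a) ⊎-dec (x ≟ b)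

  Disjoint-sym : ∀ {e e′ : Edge V} → Disjoint e e′ → Disjoint e′ e
  Disjoint-sym (a≢c , a≢d , b≢c , b≢d) =
    a≢c ∘ ≡-sym , b≢c ∘ ≡-sym , a≢d ∘ ≡-sym , b≢d ∘ ≡-sym

  Disjoint-swapʳ : ∀ {e : Edge V} {a b} → Disjoint e (a , b) → Disjoint e (b , a)
  Disjoint-swapʳ (a≢c , a≢d , b≢c , b≢d) = a≢d , a≢c , b≢d , b≢c

  Disjoint⇒Avoids : ∀ {x} {e e′ : Edge V} → Meets x e → Disjoint e e′ → Avoids x e′
  Disjoint⇒Avoids (inj₁ refl) (a≢c , a≢d , _ , _) = a≢c , a≢d
  Disjoint⇒Avoids (inj₂ refl) (_ , _ , b≢c , b≢d) = b≢c , b≢d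

  Meets-both⇒¬Disjoint : ∀ {x} {e e′ : Edge V} → Meets x e → Meets x e′ → ¬ Disjoint e e′
  Meets-both⇒¬Disjoint x∈e x∈e′ disj = Avoids⇒¬Meets (Disjoint⇒Avoids x∈e disj) x∈e′

  SameEdge-refl : ∀ {e : Edge V} → SameEdge e e
  SameEdge-refl = inj₁ (refl , refl)

  SameEdge-sym : ∀ {e e′ : Edge V} → SameEdge e e′ → SameEdge e′ e
  SameEdge-sym (inj₁ (refl , refl)) = inj₁ (refl , refl)
  SameEdge-sym (inj₂ (refl , refl)) = inj₂ (refl , refl)

  SameEdge? : DecidableEquality V → ∀ e e′ → Dec (SameEdge e e′)
  SameEdge? _≟_ (a , b) (c , d) = ((a ≟ c) ×-dec (b ≟ d)) ⊎-dec ((a ≟ d) ×-dec (b ≟ c))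

  Disjoint-respʳ-SameEdge : ∀ {e e′ e″ : Edge V} →
                            Disjoint e e′ → SameEdge e′ e″ → Disjoint e e″
  Disjoint-respʳ-SameEdge disj (inj₁ (refl , refl)) = disj
  Disjoint-respʳ-SameEdge disj (inj₂ (refl , refl)) = Disjoint-swapʳ disj

  Disjoint⇒¬SameEdge : ∀ {e e′ : Edge V} → Disjoint e e′ → ¬ SameEdge e e′
  Disjoint⇒¬SameEdge (a≢c , _ , _ , _) (inj₁ (a≡c , _)) = a≢c a≡c
  Disjoint⇒¬SameEdge (_ , a≢d , _ , _) (inj₂ (a≡d , _)) = a≢d a≡d

mapEdge : ∀ {A B : Set} → (A → B) → Edge A → Edge B
mapEdge f (a , b) = f a , f b

module _ {A B : Set} {f : A → B} where

  Meets-mapEdge : ∀ {x e} → Meets x e → Meets (f x) (mapEdge f e)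
  Meets-mapEdge (inj₁ refl) = inj₁ refl
  Meets-mapEdge (inj₂ refl) = inj₂ refl

  Disjoint-mapEdge : Injective _≡_ _≡_ f →
                     ∀ {e e′} → Disjoint e e′ → Disjoint (mapEdge f e) (mapEdge f e′)
  Disjoint-mapEdge inj (a≢c , a≢d , b≢c , b≢d) = a≢c ∘ inj , a≢d ∘ inj , b≢c ∘ inj , b≢d ∘ inj

  Disjoint-mapEdge⁻ : ∀ {e e′} → Disjoint (mapEdge f e) (mapEdge f e′) → Disjoint e e′
  Disjoint-mapEdge⁻ (a≢c , a≢d , b≢c , b≢d) =
    a≢c ∘ cong f , a≢d ∘ cong f , b≢c ∘ cong f , b≢d ∘ cong f

Disjoint-mapEdge-apart : ∀ {A A′ B : Set} {f : A → B} {g : A′ → B} → (∀ x y → f x ≢ g y) →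
                         ∀ {e e′} → Disjoint (mapEdge f e) (mapEdge g e′)
Disjoint-mapEdge-apart apart = apart _ _ , apart _ _ , apart _ _ , apart _ _

module _ {A : Set} {R : A → A → Set} where

  AllPairs⇒lookup : Symmetric R → ∀ {xs} → AllPairs R xs →
                    ∀ i j → i ≢ j → R (lookup xs i) (lookup xs j)
  AllPairs⇒lookup sym (_ ∷ _)        zero    zero    i≢j = ⊥-elim (i≢j refl)
  AllPairs⇒lookup sym (Rx ∷ _)       zero    (suc j) _   = All.lookup Rx (∈-lookup j)
  AllPairs⇒lookup sym (Rx ∷ _)       (suc i) zero    _   = sym (All.lookup Rx (∈-lookup i))
  AllPairs⇒lookup sym (_ ∷ pairwise) (suc i) (suc j) i≢j =
    AllPairs⇒lookup sym pairwise i j (i≢j ∘ cong suc)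

  lookup⇒AllPairs : ∀ xs → (∀ i j → i ≢ j → R (lookup xs i) (lookup xs j)) → AllPairs R xs
  lookup⇒AllPairs []       _ = []
  lookup⇒AllPairs (x ∷ xs) R-lookup =
    All.tabulate (λ y∈xs → subst (R x) (≡-sym (lookup-index y∈xs)) (R-lookup zero (suc (Any.index y∈xs)) λ ()))
    ∷ lookup⇒AllPairs xs λ i j i≢j → R-lookup (suc i) (suc j) (i≢j ∘ suc-injective)

module _ {V : Set} (G : SimpleGraph V) where

  IsEdge : Edge V → Set
  IsEdge (a , b) = Adj G a b

  Extends : List (Edge V) → Edge V → Set
  Extends M e = IsEdge e × All (Disjoint e) M

  Unextendable : List (Edge V) → Set
  Unextendable M = ∀ e → ¬ Extends M e

  isMatching : ∀ {M} → All IsEdge M → AllPairs Disjoint M → IsMatching G M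
  isMatching edges pairwise = record
    { edges    = All.lookup edges
    ; disjoint = AllPairs⇒lookup Disjoint-sym pairwise
    }

  module _ {M} (M-matching : IsMatching G M) where
    open IsMatching M-matching

    IsMatching⇒All : All IsEdge M
    IsMatching⇒All = All.tabulate edges

    IsMatching⇒AllPairs : AllPairs Disjoint M
    IsMatching⇒AllPairs = lookup⇒AllPairs M disjoint

    ∷-isMatching : ∀ {e} → Extends M e → IsMatching G (e ∷ M)
    ∷-isMatching (e-edge , e-disj) =
      isMatching (e-edge ∷ IsMatching⇒All) (e-disj ∷ IsMatching⇒AllPairs)

    ∈-disjoint : ∀ {e e′} → e ∈ M → e′ ∈ M → e ≢ e′ → Disjoint e e′
    ∈-disjoint e∈M e′∈M e≢e′ with Any.index e∈M Fin.≟ Any.index e′∈M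
    ... | yes i≡j = ⊥-elim (e≢e′ (begin
      _                          ≡⟨ lookup-index e∈M ⟩
      lookup M (Any.index e∈M)   ≡⟨ cong (lookup M) i≡j ⟩
      lookup M (Any.index e′∈M)  ≡⟨ lookup-index e′∈M ⟨
      _                          ∎))
      where open ≡-Reasoning
    ... | no i≢j  = subst₂ Disjoint (≡-sym (lookup-index e∈M)) (≡-sym (lookup-index e′∈M)) (disjoint _ _ i≢j)

  maximal⇒unextendable : ∀ {M} → IsMaximalMatching G M → Unextendable M
  maximal⇒unextendable {M} (M-matching , M-maximal) e ext@(_ , e-disj)
    with M-maximal (e ∷ M) (∷-isMatching M-matching ext) (λ d∈M → _ , there d∈M , SameEdge-refl) (here refl)
  ... | e′ , e′∈M , e≈e′ = Disjoint⇒¬SameEdge (All.lookup e-disj e′∈M) e≈e′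

  unextendable⇒maximal : DecidableEquality V →
                         ∀ {M} → IsMatching G M → Unextendable M → IsMaximalMatching G M
  unextendable⇒maximal _≟_ {M} M-matching M-unext = M-matching , contained
    where
    contained : ∀ M′ → IsMatching G M′ → M ⊆ᴱ M′ → M′ ⊆ᴱ M
    contained M′ M′-matching M⊆M′ {e} e∈M′ with any? (SameEdge? _≟_ e) M
    ... | yes e≈M = find e≈M
    ... | no e≉M  = ⊥-elim (M-unext e (IsMatching.edges M′-matching e∈M′ , All.tabulate disjoint))
      where
      disjoint : ∀ {d} → d ∈ M → Disjoint e d
      disjoint {d} d∈M with M⊆M′ d∈M
      ... | d′ , d′∈M′ , d≈d′ = Disjoint-respʳ-SameEdge (∈-disjoint M′-matching e∈M′ d′∈M′ e≢d′) d′≈d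
        where
        d′≈d : SameEdge d′ d
        d′≈d = SameEdge-sym d≈d′
        e≢d′ : e ≢ d′
        e≢d′ refl = e≉M (lose d∈M d′≈d)

finSum-zero : ∀ {s} → finSum {s} (λ _ → 0) ≡ 0
finSum-zero {zero}  = refl
finSum-zero {suc s} = finSum-zero {s}

finSum-cong : ∀ {s} {f g : Fin s → ℕ} → (∀ i → f i ≡ g i) → finSum f ≡ finSum g
finSum-cong {zero}  f≗g = refl
finSum-cong {suc s} f≗g = cong₂ _+_ (f≗g zero) (finSum-cong (f≗g ∘ suc))

finSum-mono-≤ : ∀ {s} {f g : Fin s → ℕ} → (∀ i → f i ≤ g i) → finSum f ≤ finSum g
finSum-mono-≤ {zero}  f≤g = z≤n
finSum-mono-≤ {suc s} f≤g = +-mono-≤ (f≤g zero) (finSum-mono-≤ (f≤g ∘ suc))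

finSum-+ : ∀ {s} (f g : Fin s → ℕ) → finSum (λ i → f i + g i) ≡ finSum f + finSum g
finSum-+ {zero}  f g = refl
finSum-+ {suc s} f g = begin
  (f zero + g zero) + finSum (λ i → f (suc i) + g (suc i))
    ≡⟨ cong (f zero + g zero +_) (finSum-+ (f ∘ suc) (g ∘ suc)) ⟩
  (f zero + g zero) + (finSum (f ∘ suc) + finSum (g ∘ suc))
    ≡⟨ interchange (f zero) (g zero) _ _ ⟩
  (f zero + finSum (f ∘ suc)) + (g zero + finSum (g ∘ suc)) ∎
  where open ≡-Reasoning

δ : ∀ {s} → Fin s → Fin s → ℕ
δ zero    zero    = 1
δ zero    (suc _) = 0
δ (suc _) zero    = 0
δ (suc i) (suc j) = δ i j

δ-diag : ∀ {s} (i : Fin s) → δ i i ≡ 1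
δ-diag zero    = refl
δ-diag (suc i) = δ-diag i

finSum-δ : ∀ {s} (i : Fin s) → finSum (δ i) ≡ 1
finSum-δ {suc s} zero    = cong suc (finSum-zero {s})
finSum-δ         (suc i) = finSum-δ i

length-concat-tabulate : ∀ {A : Set} {s} (xs : Fin s → List A) →
                         length (concat (tabulate xs)) ≡ finSum (length ∘ xs)
length-concat-tabulate {s = zero}  xs = refl
length-concat-tabulate {s = suc s} xs =
  ≡-trans (length-++ (xs zero)) (cong (length (xs zero) +_) (length-concat-tabulate (xs ∘ suc)))

module Gluing (s : ℕ) (n : Fin s → ℕ) (H : (i : Fin s) → FinGraph (n i))
              (vs : (i : Fin s) → Fin (n i)) where
  open Glue s n H vs using (G; inner; toV; fromV)

  W : Set
  W = GVertex s n

  _≟_ : DecidableEquality W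
  _≟_ = Sum.≡-dec (Product.≡-dec Fin._≟_ Fin._≟_) Unit._≟_

  embed : (i : Fin s) → Fin (n i) → W
  embed i x = inj₁ (i , x)

  apex : W
  apex = inj₂ tt

  embed-injective : ∀ i → Injective _≡_ _≡_ (embed i)
  embed-injective i refl = refl

  embed-apart : ∀ {i j} → i ≢ j → ∀ x y → embed i x ≢ embed j y
  embed-apart i≢j _ _ refl = i≢j refl

  lift : (i : Fin s) → Edge (Fin (n i)) → Edge W
  lift i = mapEdge (embed i)

  lift-apart : ∀ {i j} → i ≢ j → ∀ d d′ → Disjoint (lift i d) (lift j d′)
  lift-apart i≢j _ _ = Disjoint-mapEdge-apart (embed-apart i≢j)

  spoke : Fin s → Edge W
  spoke i = embed i (vs i) , apex

  module _ (M : (i : Fin s) → List (Edge (Fin (n i)))) where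

    lifted : Fin s → List (Edge W)
    lifted i = map (lift i) (M i)

    union : List (Edge W)
    union = concat (tabulate lifted)

    ∈-union⁺ : ∀ {i d} → d ∈ M i → lift i d ∈ union
    ∈-union⁺ {i} d∈M = ∈-concat⁺′ (∈-map⁺ (lift i) d∈M) (∈-tabulate⁺ i)

    ∈-union⁻ : ∀ {e} → e ∈ union → ∃₂ λ i d → d ∈ M i × e ≡ lift i d
    ∈-union⁻ e∈union with ∈-concat⁻′ _ e∈union
    ... | _ , e∈Mᵢ , Mᵢ∈ with ∈-tabulate⁻ {f = lifted} Mᵢ∈
    ...   | i , refl with ∈-map⁻ (lift i) e∈Mᵢ
    ...     | d , d∈M , e≡ = i , d , d∈M , e≡

    length-union : length union ≡ finSum (λ i → length (M i))
    length-union =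
      ≡-trans (length-concat-tabulate lifted) (finSum-cong λ i → length-map (lift i) (M i))

    union-isMatching : (∀ i → IsMatching (H i) (M i)) → IsMatching G union
    union-isMatching matching = isMatching G
      (All.tabulate λ e∈union → case ∈-union⁻ e∈union of λ where
        (i , d , d∈M , refl) → inner i _ _ (IsMatching.edges (matching i) d∈M))
      (AllPairs.concat⁺
        (All.tabulate⁺ λ i → AllPairs.map⁺
          (AllPairs.map (Disjoint-mapEdge (embed-injective i)) (IsMatching⇒AllPairs (H i) (matching i))))
        (AllPairs.tabulate⁺ λ i≢j →
          All.map⁺ (All.universal (λ d → All.map⁺ (All.universal (lift-apart i≢j d) _)) _)))

    union-unextendable : (∀ i → IsMaximalMatching (H i) (M i)) → (∀ i → Covered (vs i) (M i)) →
                         Unextendable G union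
    union-unextendable maximal covered = λ where
        (._ , ._) (inner i x y adj , disj) → maximal⇒unextendable (H i) (maximal i) (x , y)
          (adj , All.tabulate λ d∈M → Disjoint-mapEdge⁻ (All.lookup disj (∈-union⁺ d∈M)))
        (._ , ._) (toV i , disj)   → blocked-at-vs i disj (inj₁ refl)
        (._ , ._) (fromV i , disj) → blocked-at-vs i disj (inj₂ refl)
      where
      blocked-at-vs : ∀ i {e} → All (Disjoint e) union → ¬ Meets (embed i (vs i)) e
      blocked-at-vs i disj vᵢ∈e with covered i
      ... | d , d∈M , vᵢ∈d =
        Meets-both⇒¬Disjoint vᵢ∈e (Meets-mapEdge vᵢ∈d) (All.lookup disj (∈-union⁺ d∈M))

    union-maximal : (∀ i → IsMaximalMatching (H i) (M i)) → (∀ i → Covered (vs i) (M i)) →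
                    IsMaximalMatching G union
    union-maximal maximal covered = unextendable⇒maximal G _≟_
      (union-isMatching (proj₁ ∘ maximal)) (union-unextendable maximal covered)

  unlift : (i : Fin s) → Edge W → Maybe (Edge (Fin (n i)))
  unlift i (inj₁ (j , x) , inj₁ (j′ , y)) with j Fin.≟ i | j′ Fin.≟ i
  ... | yes refl | yes refl = just (x , y)
  ... | _        | _        = nothing
  unlift i _ = nothing

  unlift-lift : ∀ i d → unlift i (lift i d) ≡ just d
  unlift-lift i _ with i Fin.≟ i
  ... | yes refl = refl
  ... | no i≢i   = ⊥-elim (i≢i refl)

  unlift-sound : ∀ {i} e {d} → unlift i e ≡ just d → e ≡ lift i d
  unlift-sound {i} (inj₁ (j , x) , inj₁ (j′ , y)) eq with j Fin.≟ i | j′ Fin.≟ i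
  unlift-sound (inj₁ (j , x) , inj₁ (j′ , y)) refl | yes refl | yes refl = refl
  unlift-sound (inj₁ (j , x) , inj₁ (j′ , y)) ()   | yes refl | no _
  unlift-sound (inj₁ (j , x) , inj₁ (j′ , y)) ()   | no _     | _
  unlift-sound (inj₁ _ , inj₂ _) ()
  unlift-sound (inj₂ _ , _)      ()

  restrict : (i : Fin s) → List (Edge W) → List (Edge (Fin (n i)))
  restrict i = mapMaybe (unlift i)

  ∈-restrict⁺ : ∀ {i M d} → lift i d ∈ M → d ∈ restrict i M
  ∈-restrict⁺ {i} {d = d} (here refl) rewrite unlift-lift i d = here refl
  ∈-restrict⁺ {i} {e ∷ _} (there d∈M) with unlift i e
  ... | nothing = ∈-restrict⁺ d∈M
  ... | just _  = there (∈-restrict⁺ d∈M)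

  ∈-restrict⁻ : ∀ {i M d} → d ∈ restrict i M → lift i d ∈ M
  ∈-restrict⁻ {i} {e ∷ _} d∈L with unlift i e in eq
  ... | nothing = there (∈-restrict⁻ d∈L)
  ... | just _ with d∈L
  ...   | here refl = here (≡-sym (unlift-sound e eq))
  ...   | there d∈L′ = there (∈-restrict⁻ d∈L′)

  restrict-pairwise : ∀ {i M} → AllPairs Disjoint M → AllPairs Disjoint (restrict i M)
  restrict-pairwise     {M = []}    []                  = []
  restrict-pairwise {i} {M = e ∷ M} (e-disj ∷ pairwise) with unlift i e in eq
  ... | nothing = restrict-pairwise pairwise
  ... | just d  = All.tabulate d-disj ∷ restrict-pairwise pairwise
    where
    d-disj : ∀ {d′} → d′ ∈ restrict i M → Disjoint d d′
    d-disj d′∈L = Disjoint-mapEdge⁻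
      (subst (λ e → Disjoint e _) (unlift-sound e eq) (All.lookup e-disj (∈-restrict⁻ d′∈L)))

  restrict-isMatching : ∀ {M} → IsMatching G M → ∀ i → IsMatching (H i) (restrict i M)
  restrict-isMatching M-matching i = isMatching (H i)
    (All.tabulate λ d∈L → inner⁻ (IsMatching.edges M-matching (∈-restrict⁻ d∈L)))
    (restrict-pairwise (IsMatching⇒AllPairs G M-matching))
    where
    inner⁻ : ∀ {x y} → IsEdge G (lift i (x , y)) → Adj (H i) x y
    inner⁻ (inner _ _ _ adj) = adj

  -- Charges an edge to the component of its first non-apex endpoint: an edge of G inside Hᵢ
  -- or on the spoke at vᵢ is charged to i, and every edge to at most one component.
  weight : Fin s → Edge W → ℕ
  weight i (inj₁ (j , _) , _)      = δ j i
  weight i (inj₂ _ , inj₁ (j , _)) = δ j i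
  weight i (inj₂ _ , inj₂ _)       = 0

  weight-unlift : ∀ {i} e {d} → unlift i e ≡ just d → weight i e ≡ 1
  weight-unlift {i} e eq rewrite unlift-sound e eq = δ-diag i

  finSum-weight≤1 : ∀ e → finSum (λ i → weight i e) ≤ 1
  finSum-weight≤1 (inj₁ (j , _) , _)      = ≤-reflexive (finSum-δ j)
  finSum-weight≤1 (inj₂ _ , inj₁ (j , _)) = ≤-reflexive (finSum-δ j)
  finSum-weight≤1 (inj₂ _ , inj₂ _)       = ≤-trans (≤-reflexive (finSum-zero {s})) z≤n

  owned : Fin s → List (Edge W) → ℕ
  owned i M = sum (map (weight i) M)

  finSum-owned≤length : ∀ M → finSum (λ i → owned i M) ≤ length M
  finSum-owned≤length []      = ≤-reflexive (finSum-zero {s})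
  finSum-owned≤length (e ∷ M) = begin
    finSum (λ i → weight i e + owned i M)
      ≡⟨ finSum-+ (λ i → weight i e) (λ i → owned i M) ⟩
    finSum (λ i → weight i e) + finSum (λ i → owned i M)
      ≤⟨ +-mono-≤ (finSum-weight≤1 e) (finSum-owned≤length M) ⟩
    suc (length M)                                        ∎
    where open ≤-Reasoning

  length-restrict≤owned : ∀ i M → length (restrict i M) ≤ owned i M
  length-restrict≤owned i []      = z≤n
  length-restrict≤owned i (e ∷ M) with unlift i e in eq
  ... | nothing = ≤-trans (length-restrict≤owned i M) (m≤n+m _ _)
  ... | just _ rewrite weight-unlift e eq = s≤s (length-restrict≤owned i M)

  SpokeIn : Fin s → List (Edge W) → Set
  SpokeIn i = Any (SameEdge (spoke i))

  spokeIn? : ∀ i M → Dec (SpokeIn i M)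
  spokeIn? i = any? (SameEdge? _≟_ (spoke i))

  spokeIn⇒1+length-restrict≤owned : ∀ {i M} → SpokeIn i M → suc (length (restrict i M)) ≤ owned i M
  spokeIn⇒1+length-restrict≤owned {i} {_ ∷ M} (here (inj₁ (refl , refl)))
    rewrite δ-diag i = s≤s (length-restrict≤owned i M)
  spokeIn⇒1+length-restrict≤owned {i} {_ ∷ M} (here (inj₂ (refl , refl)))
    rewrite δ-diag i = s≤s (length-restrict≤owned i M)
  spokeIn⇒1+length-restrict≤owned {i} {e ∷ M} (there spoke) with unlift i e in eq
  ... | nothing = ≤-trans (spokeIn⇒1+length-restrict≤owned spoke) (m≤n+m _ _)
  ... | just _ rewrite weight-unlift e eq = s≤s (spokeIn⇒1+length-restrict≤owned spoke)

  lift-extension : ∀ {M i d} → IsMatching G M → Extends (H i) (restrict i M) d →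
                   (SpokeIn i M → Avoids (vs i) d) → Extends G M (lift i d)
  lift-extension {M} {i} {d} M-matching (adj , d-disj) avoids =
    inner i _ _ adj , All.tabulate λ e∈M → disjoint e∈M (IsMatching.edges M-matching e∈M)
    where
    disjoint-spoke : ∀ j → SpokeIn j M → Disjoint (lift i d) (spoke j)
    disjoint-spoke j spoke with j Fin.≟ i
    ... | yes refl = let vᵢ≢d₁ , vᵢ≢d₂ = avoids spoke in
      vᵢ≢d₁ ∘ ≡-sym ∘ embed-injective i , (λ ()) , vᵢ≢d₂ ∘ ≡-sym ∘ embed-injective i , (λ ())
    ... | no j≢i = embed-apart (j≢i ∘ ≡-sym) _ _ , (λ ()) , embed-apart (j≢i ∘ ≡-sym) _ _ , (λ ())

    disjoint : ∀ {a b} → (a , b) ∈ M → IsEdge G (a , b) → Disjoint (lift i d) (a , b)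
    disjoint e∈M (inner j x y _) with j Fin.≟ i
    ... | yes refl = Disjoint-mapEdge (embed-injective i) (All.lookup d-disj (∈-restrict⁺ e∈M))
    ... | no j≢i   = lift-apart (j≢i ∘ ≡-sym) d (x , y)
    disjoint e∈M (toV j)   = disjoint-spoke j (lose e∈M SameEdge-refl)
    disjoint e∈M (fromV j) = Disjoint-swapʳ (disjoint-spoke j (lose e∈M (inj₂ (refl , refl))))

  module _ {M} (M-matching : IsMatching G M) (M-unext : Unextendable G M) (i : Fin s)
           {k} (k-min : ∀ N → IsMaximalMatching (H i) N → k ≤ size N) where

    private
      L : List (Edge (Fin (n i)))
      L = restrict i M

      L-matching : IsMatching (H i) L
      L-matching = restrict-isMatching M-matching i

    restrict-maximal : ¬ SpokeIn i M → IsMaximalMatching (H i) L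
    restrict-maximal ¬spoke = unextendable⇒maximal (H i) Fin._≟_ L-matching λ d ext →
      M-unext (lift i d) (lift-extension M-matching ext (⊥-elim ∘ ¬spoke))

    ∷-restrict-maximal : ∀ {d} → Extends (H i) L d → Meets (vs i) d → IsMaximalMatching (H i) (d ∷ L)
    ∷-restrict-maximal ext vᵢ∈d = unextendable⇒maximal (H i) Fin._≟_ (∷-isMatching (H i) L-matching ext)
      λ { d′ (adj , d′-disj-d ∷ d′-disj) → M-unext (lift i d′)
            (lift-extension M-matching (adj , d′-disj) λ _ → Disjoint⇒Avoids vᵢ∈d (Disjoint-sym d′-disj-d)) }

    -- Adjacency in Hᵢ need not be decidable, so we cannot ask whether some edge at vᵢ extends L;
    -- arguing by contradiction on the decidable k ≤ 1 + |L| sidesteps this.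
    min-match≤1+length-restrict : k ≤ suc (length L)
    min-match≤1+length-restrict = decidable-stable (k ≤? suc (length L)) λ k≰ →
      k≰ (≤-trans (k-min L (unextendable⇒maximal (H i) Fin._≟_ L-matching (L-unext k≰))) (n≤1+n _))
      where
      L-unext : ¬ k ≤ suc (length L) → Unextendable (H i) L
      L-unext k≰ d ext with Meets? Fin._≟_ (vs i) d
      ... | yes vᵢ∈d = k≰ (k-min (d ∷ L) (∷-restrict-maximal ext vᵢ∈d))
      ... | no vᵢ∉d  = M-unext (lift i d) (lift-extension M-matching ext λ _ → ¬Meets⇒Avoids vᵢ∉d)

    min-match≤owned : k ≤ owned i M
    min-match≤owned with spokeIn? i M
    ... | yes spoke = ≤-trans min-match≤1+length-restrict (spokeIn⇒1+length-restrict≤owned spoke)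
    ... | no ¬spoke = ≤-trans (k-min L (restrict-maximal ¬spoke)) (length-restrict≤owned i M)

theorem1p10 : (s : ℕ) → 2 ≤ s →
    (n : Fin s → ℕ) → (H : (i : Fin s) → FinGraph (n i)) →
    (∀ i → Connected (H i)) →
    (vs : (i : Fin s) → Fin (n i)) →
    (k : Fin s → ℕ) → (∀ i → IsMinMatch (H i) (k i)) →
    (∀ i → (M : List (Edge (Fin (n i)))) → IsMaximalMatching (H i) M →
       size M ≡ k i → Covered (vs i) M) →
    IsMinMatch (glue s n H vs) (finSum k)
theorem1p10 s _ n H _ vs k k-minMatch covers = upper , lower
  where
  open Gluing s n H vs

  M : (i : Fin s) → List (Edge (Fin (n i)))
  M i = proj₁ (proj₁ (k-minMatch i))

  M-maximal : ∀ i → IsMaximalMatching (H i) (M i)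
  M-maximal i = proj₁ (proj₂ (proj₁ (k-minMatch i)))

  M-size : ∀ i → size (M i) ≡ k i
  M-size i = proj₂ (proj₂ (proj₁ (k-minMatch i)))

  upper : ∃[ N ] (IsMaximalMatching (glue s n H vs) N × size N ≡ finSum k)
  upper = union M , union-maximal M M-maximal (λ i → covers i (M i) (M-maximal i) (M-size i)) ,
          ≡-trans (length-union M) (finSum-cong M-size)

  lower : ∀ N → IsMaximalMatching (glue s n H vs) N → finSum k ≤ size N
  lower N N-maximal@(N-matching , _) = begin
    finSum k
      ≤⟨ finSum-mono-≤ (λ i → min-match≤owned N-matching N-unext i (proj₂ (k-minMatch i))) ⟩
    finSum (λ i → owned i N)
      ≤⟨ finSum-owned≤length N ⟩
    size N ∎
    where
    open ≤-Reasoning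
    N-unext : Unextendable (glue s n H vs) N
    N-unext = maximal⇒unextendable _ N-maximal
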